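{- Let $u,v\in\mathbb{Q}$, not both zero. Let $A$ be the free zinbiel algebra over $\mathbb{Q}$ on the two generators $0$ and $1$, and let $\mathsf{A}_{1,0}\subset A$ be the subspace spanned by the words starting with $1$ and ending with $0$. Put $z_2=(1,0)$ and $z_3=u\,(1,0,0)+v\,(1,1,0)$ in $\mathsf{A}_{1,0}$, and let $C_{u,v}$ be the zinbiel sub-algebra of $\mathsf{A}_{1,0}$ generated by $z_2$ and $z_3$. Then $C_{u,v}$ is a free zinbiel algebra over $\mathbb{Q}$ on the two generators $z_2,z_3$. Equivalently, the unique zinbiel morphism from the free zinbiel algebra on two letters $x_2,x_3$ to $C_{u,v}$ sending $x_2\mapsto z_2$ and $x_3\mapsto z_3$ is an isomorphism.
   Context: A zinbiel algebra over a commutative ring $R$ is an $R$-module $L$ with a bilinear product $\prec$ satisfying $(x\prec y)\prec z = x\prec(y\prec z)+x\prec(z\prec y)$ for all $x,y,z\in L$. The free zinbiel algebra on a finite set $S$ over $\mathbb{Q}$ has as basis the non-empty words in the alphabet $S$. In this basis, the product $w\prec w'$ of two words is the sum, with multiplicity, of the words in the shuffle product of $w$ and $w'$ whose first letter is the first letter of $w$. For example, in $A$ one has $(10)\prec(10)=(1010)+2(1100)$. The subspace $\mathsf{A}_{1,0}$ is closed under $\prec$. -}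

module Defs where

open import Data.Nat using (ℕ)
open import Data.Fin using (Fin; zero; suc)
import Data.Fin.Properties as FinP
open import Data.List using (List; []; _∷_; _++_; map; concatMap)
import Data.List.Properties as ListP
open import Data.Product using (_×_; _,_; Σ; ∃)
import Data.Product.Properties as ProdP
open import Data.Rational using (ℚ; 0ℚ; 1ℚ; _+_; _*_)
open import Relation.Binary.PropositionalEquality using (_≡_; refl)
open import Relation.Binary.Definitions using (DecidableEquality)
open import Relation.Nullary using (yes; no)

-- A non-empty word is represented as (first letter , remaining letters).
-- An element is a finite formal ℚ-linear combination of non-empty words,
-- represented by a list of (coefficient , word); two such lists denote
-- the same element iff all word-coefficients agree (relation _≈_).

module FreeZinbiel (S : Set) (_≟S_ : DecidableEquality S) where

  Word : Set
  Word = S × List S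

  _≟W_ : DecidableEquality Word
  _≟W_ = ProdP.≡-dec _≟S_ (ListP.≡-dec _≟S_)

  Elt : Set
  Elt = List (ℚ × Word)

  coeff : Elt → Word → ℚ
  coeff [] w = 0ℚ
  coeff ((c , w′) ∷ p) w with w′ ≟W w
  ... | yes _ = c + coeff p w
  ... | no  _ = coeff p w

  _≈_ : Elt → Elt → Set
  p ≈ q = ∀ w → coeff p w ≡ coeff q w

  zeroE : Elt
  zeroE = []

  _⊕_ : Elt → Elt → Elt
  p ⊕ q = p ++ q

  _•_ : ℚ → Elt → Elt
  c • p = map (λ { (d , w) → (c * d , w) }) p

  word : Word → Elt
  word w = (1ℚ , w) ∷ []

  shuffles : List S → List S → List (List S)
  shuffles [] v = v ∷ []
  shuffles (a ∷ u) [] = (a ∷ u) ∷ []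
  shuffles (a ∷ u) (b ∷ v) =
    map (a ∷_) (shuffles u (b ∷ v)) ++ map (b ∷_) (shuffles (a ∷ u) v)

  _≺W_ : Word → Word → List Word
  (a , u) ≺W (b , v) = map (λ t → (a , t)) (shuffles u (b ∷ v))

  _≺_ : Elt → Elt → Elt
  p ≺ q = concatMap (λ { (c , w) →
            concatMap (λ { (d , w′) →
              map (λ t → (c * d , t)) (w ≺W w′) }) q }) p

open module A = FreeZinbiel (Fin 2) FinP._≟_ public
  renaming (Word to WordA; Elt to EltA; coeff to coeffA; _≈_ to _≈A_;
            zeroE to zeroA; _⊕_ to _⊕A_; _•_ to _•A_; word to wordA;
            _≺_ to _≺A_; _≺W_ to _≺WA_; shuffles to shufflesA; _≟W_ to _≟WA_)

l0 l1 : Fin 2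
l0 = zero
l1 = suc zero

z₂ : EltA
z₂ = wordA (l1 , l0 ∷ [])

z₃ : ℚ → ℚ → EltA
z₃ u v = (u , (l1 , l0 ∷ l0 ∷ [])) ∷ (v , (l1 , l1 ∷ l0 ∷ [])) ∷ []

data InC (u v : ℚ) : EltA → Set where
  gen₂  : InC u v z₂
  gen₃  : InC u v (z₃ u v)
  czero : InC u v zeroA
  cadd  : ∀ {a b} → InC u v a → InC u v b → InC u v (a ⊕A b)
  cscal : ∀ c {a} → InC u v a → InC u v (c •A a)
  cprod : ∀ {a b} → InC u v a → InC u v b → InC u v (a ≺A b)
  cresp : ∀ {a b} → a ≈A b → InC u v a → InC u v b

data Gen : Set where
  x₂ x₃ : Gen

_≟G_ : DecidableEquality Gen
x₂ ≟G x₂ = yes refl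
x₂ ≟G x₃ = no (λ ())
x₃ ≟G x₂ = no (λ ())
x₃ ≟G x₃ = yes refl

open module X = FreeZinbiel Gen _≟G_ public
  renaming (Word to WordX; Elt to EltX; coeff to coeffX; _≈_ to _≈X_;
            zeroE to zeroX; _⊕_ to _⊕X_; _•_ to _•X_; word to wordX;
            _≺_ to _≺X_; _≺W_ to _≺WX_; shuffles to shufflesX; _≟W_ to _≟WX_)

-- In the free zinbiel algebra the word a₁a₂…aₙ equals
-- a₁ ≺ (a₂ ≺ (… ≺ aₙ)), so φ is forced on words by this formula,
-- and extended ℚ-linearly.
module _ (u v : ℚ) where

  φgen : Gen → EltA
  φgen x₂ = z₂
  φgen x₃ = z₃ u v

  φword′ : Gen → List Gen → EltA
  φword′ a [] = φgen a
  φword′ a (b ∷ t) = φgen a ≺A φword′ b t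

  φ : EltX → EltA
  φ p = concatMap (λ { (c , (a , t)) → c •A φword′ a t }) p

{-# OPTIONS --safe #-}

-- Elements are compared through all linear functionals on words; against these the
-- zinbiel identity in A reduces to commutativity and associativity of shuffles, so φ
-- is a morphism, and its image is C_{u,v}.
-- For injectivity, order the words of A by length and then lexicographically with
-- 1 below 0. Put t(x₂) = 0, and t(x₃) = 00 if u ≠ 0, t(x₃) = 10 if u = 0. For a word
-- a₁⋯aₙ in x₂, x₃, every word of φ(a₁⋯aₙ) with nonzero coefficient is at most
-- 1t(a₁)1t(a₂)⋯1t(aₙ), whose own coefficient is nonzero. Distinct words have distinct
-- leading words, so for r ≠ 0 the leading word of the largest word in the support of r
-- survives in φ r.

module Submission where

open import Defs
open import Algebra.Bundles using (CommutativeMonoid)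
import Algebra.Properties.CommutativeSemigroup as CommSemigroupProperties
open import Data.Empty using (⊥-elim)
open import Data.Fin using (Fin; zero; suc)
import Data.Fin.Properties as FinP
open import Data.List using (List; []; _∷_; _++_; map; concatMap; length; replicate; filter)
import Data.List.Properties as LP
open import Data.List.Relation.Unary.All as All using (All; []; _∷_)
import Data.List.Relation.Unary.All.Properties as AllP
open import Data.List.Relation.Unary.Any using (here; there)
import Data.List.Relation.Unary.Any.Properties as AnyP
open import Data.List.Membership.Propositional using (_∈_)
open import Data.List.Membership.Propositional.Properties using (∈-map⁺; ∈-filter⁺)
open import Data.Nat as ℕ using (ℕ; zero; suc; z≤n; s≤s)
import Data.Nat.Properties as NP
open import Data.Nat.Induction using (<-wellFounded)
open import Data.Product using (_×_; _,_; ∃; proj₁; proj₂)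
import Data.Product as Product
open import Data.Rational using (ℚ; 0ℚ; 1ℚ; _+_; _*_; -_; _-_; _≤_; 1/_; ≢-nonZero)
import Data.Rational.Properties as QP
import Data.List.Extrema as Extrema
open import Algebra.Properties.Group QP.+-0-group using (x∙y⁻¹≈ε⇒x≈y)
open import Data.Sum using (_⊎_; inj₁; inj₂)
import Data.Sum as Sum
open import Function using (_∘_)
open import Induction.WellFounded using (Acc; acc)
open import Relation.Binary.Bundles using (TotalOrder)
open import Relation.Binary.Definitions using (DecidableEquality; tri<; tri≈; tri>)
open import Relation.Binary.PropositionalEquality
open import Relation.Nullary using (¬_; Dec; yes; no)
open import Relation.Nullary.Decidable using (¬?)

module +ℚ = CommSemigroupProperties (CommutativeMonoid.commutativeSemigroup QP.+-0-commutativeMonoid)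
module *ℚ = CommSemigroupProperties (CommutativeMonoid.commutativeSemigroup QP.*-1-commutativeMonoid)

*-≢0 : ∀ {p q} → p ≢ 0ℚ → q ≢ 0ℚ → p * q ≢ 0ℚ
*-≢0 {p} {q} p≢0 q≢0 pq≡0 = q≢0 (begin
    q                ≡⟨ sym (QP.*-identityˡ q) ⟩
    1ℚ * q           ≡⟨ cong (_* q) (sym (QP.*-inverseˡ p)) ⟩
    (1/ p * p) * q   ≡⟨ QP.*-assoc (1/ p) p q ⟩
    1/ p * (p * q)   ≡⟨ cong (1/ p *_) pq≡0 ⟩
    1/ p * 0ℚ        ≡⟨ QP.*-zeroʳ (1/ p) ⟩
    0ℚ               ∎)
  where
    open ≡-Reasoning
    instance _ = ≢-nonZero p≢0

*-≡0 : ∀ {p q} → p ≡ 0ℚ ⊎ q ≡ 0ℚ → p * q ≡ 0ℚ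
*-≡0 {q = q} (inj₁ refl) = QP.*-zeroˡ q
*-≡0 {p = p} (inj₂ refl) = QP.*-zeroʳ p

-1*p≡-p : ∀ p → (- 1ℚ) * p ≡ - p
-1*p≡-p p = trans (sym (QP.neg-distribˡ-* 1ℚ p)) (cong -_ (QP.*-identityˡ p))

-- Finite sums and linear functionals

sumBy : {X : Set} → (X → ℚ) → List X → ℚ
sumBy f []       = 0ℚ
sumBy f (x ∷ xs) = f x + sumBy f xs

module _ {X : Set} where

  sumBy-++ : ∀ (f : X → ℚ) xs ys → sumBy f (xs ++ ys) ≡ sumBy f xs + sumBy f ys
  sumBy-++ f []       ys = sym (QP.+-identityˡ _)
  sumBy-++ f (x ∷ xs) ys =
    trans (cong (f x +_) (sumBy-++ f xs ys)) (sym (QP.+-assoc (f x) _ _))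

  sumBy-cong : ∀ {f g : X → ℚ} xs → (∀ x → f x ≡ g x) → sumBy f xs ≡ sumBy g xs
  sumBy-cong []       f≗g = refl
  sumBy-cong (x ∷ xs) f≗g = cong₂ _+_ (f≗g x) (sumBy-cong xs f≗g)

  sumBy-+ : ∀ (f g : X → ℚ) xs → sumBy (λ x → f x + g x) xs ≡ sumBy f xs + sumBy g xs
  sumBy-+ f g []       = refl
  sumBy-+ f g (x ∷ xs) =
    trans (cong (f x + g x +_) (sumBy-+ f g xs)) (+ℚ.interchange (f x) (g x) _ _)

  sumBy-*ˡ : ∀ c (f : X → ℚ) xs → sumBy (λ x → c * f x) xs ≡ c * sumBy f xs
  sumBy-*ˡ c f []       = sym (QP.*-zeroʳ c)
  sumBy-*ˡ c f (x ∷ xs) =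
    trans (cong (c * f x +_) (sumBy-*ˡ c f xs)) (sym (QP.*-distribˡ-+ c (f x) _))

  sumBy-vanish : ∀ {f : X → ℚ} {xs} → All (λ x → f x ≡ 0ℚ) xs → sumBy f xs ≡ 0ℚ
  sumBy-vanish []           = refl
  sumBy-vanish (fx≡0 ∷ all) = trans (cong₂ _+_ fx≡0 (sumBy-vanish all)) (QP.+-identityˡ 0ℚ)

sumBy-swap : ∀ {X Y : Set} (F : X → Y → ℚ) xs ys →
  sumBy (λ x → sumBy (F x) ys) xs ≡ sumBy (λ y → sumBy (λ x → F x y) xs) ys
sumBy-swap F []       ys = sym (sumBy-vanish (All.universal (λ _ → refl) ys))
sumBy-swap F (x ∷ xs) ys =
  trans (cong (sumBy (F x) ys +_) (sumBy-swap F xs ys))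
        (sym (sumBy-+ (F x) (λ y → sumBy (λ x → F x y) xs) ys))

sumBy-map : ∀ {X Y : Set} (f : Y → ℚ) (g : X → Y) xs → sumBy f (map g xs) ≡ sumBy (f ∘ g) xs
sumBy-map f g []       = refl
sumBy-map f g (x ∷ xs) = cong (f (g x) +_) (sumBy-map f g xs)

sumBy-concatMap : ∀ {X Y : Set} (f : Y → ℚ) (g : X → List Y) xs →
  sumBy f (concatMap g xs) ≡ sumBy (sumBy f ∘ g) xs
sumBy-concatMap f g []       = refl
sumBy-concatMap f g (x ∷ xs) =
  trans (sumBy-++ f (g x) (concatMap g xs)) (cong (sumBy f (g x) +_) (sumBy-concatMap f g xs))

module _ {W : Set} where

  eval : (W → ℚ) → List (ℚ × W) → ℚ
  eval f = sumBy (λ e → proj₁ e * f (proj₂ e))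

  eval-++ : ∀ f p q → eval f (p ++ q) ≡ eval f p + eval f q
  eval-++ f = sumBy-++ _

  eval-cong : ∀ {f g} p → (∀ w → f w ≡ g w) → eval f p ≡ eval g p
  eval-cong p f≗g = sumBy-cong p (λ e → cong (proj₁ e *_) (f≗g (proj₂ e)))

  eval-congᴬ : ∀ {f g p} → All (λ e → proj₁ e ≡ 0ℚ ⊎ f (proj₂ e) ≡ g (proj₂ e)) p →
               eval f p ≡ eval g p
  eval-congᴬ [] = refl
  eval-congᴬ {f} {g} {(c , w) ∷ p} (inj₁ refl ∷ agree) =
    cong₂ _+_ (trans (QP.*-zeroˡ (f w)) (sym (QP.*-zeroˡ (g w)))) (eval-congᴬ agree)
  eval-congᴬ {p = (c , w) ∷ p} (inj₂ fw≡gw ∷ agree) =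
    cong₂ _+_ (cong (c *_) fw≡gw) (eval-congᴬ agree)

  eval-+ : ∀ f g p → eval (λ w → f w + g w) p ≡ eval f p + eval g p
  eval-+ f g p = trans (sumBy-cong p (λ e → QP.*-distribˡ-+ (proj₁ e) _ _)) (sumBy-+ _ _ p)

  eval-*ˡ : ∀ c f p → eval (λ w → c * f w) p ≡ c * eval f p
  eval-*ˡ c f p =
    trans (sumBy-cong p (λ e → *ℚ.x∙yz≈y∙xz (proj₁ e) c (f (proj₂ e)))) (sumBy-*ˡ c _ p)

  eval-*ʳ : ∀ c f p → eval (λ w → f w * c) p ≡ eval f p * c
  eval-*ʳ c f p =
    trans (eval-cong p (λ w → QP.*-comm (f w) c)) (trans (eval-*ˡ c f p) (QP.*-comm c _))

eval-swap : ∀ {V W : Set} (F : V → W → ℚ) (p : List (ℚ × V)) (q : List (ℚ × W)) →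
  eval (λ w → eval (F w) q) p ≡ eval (λ w′ → eval (λ w → F w w′) p) q
eval-swap F p q = begin
  sumBy (λ e → proj₁ e * sumBy (λ e′ → proj₁ e′ * F (proj₂ e) (proj₂ e′)) q) p
    ≡⟨ sumBy-cong p (λ e → sym (sumBy-*ˡ (proj₁ e) _ q)) ⟩
  sumBy (λ e → sumBy (λ e′ → proj₁ e * (proj₁ e′ * F (proj₂ e) (proj₂ e′))) q) p
    ≡⟨ sumBy-swap _ p q ⟩
  sumBy (λ e′ → sumBy (λ e → proj₁ e * (proj₁ e′ * F (proj₂ e) (proj₂ e′))) p) q
    ≡⟨ sumBy-cong q (λ e′ → sumBy-cong p (λ e → *ℚ.x∙yz≈y∙xz (proj₁ e) (proj₁ e′) _)) ⟩
  sumBy (λ e′ → sumBy (λ e → proj₁ e′ * (proj₁ e * F (proj₂ e) (proj₂ e′))) p) q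
    ≡⟨ sumBy-cong q (λ e′ → sumBy-*ˡ (proj₁ e′) _ p) ⟩
  sumBy (λ e′ → proj₁ e′ * sumBy (λ e → proj₁ e * F (proj₂ e) (proj₂ e′)) p) q ∎
  where open ≡-Reasoning

sumBy-eval : ∀ {X W : Set} (F : X → W → ℚ) xs (r : List (ℚ × W)) →
  sumBy (λ x → eval (F x) r) xs ≡ eval (λ w → sumBy (λ x → F x w) xs) r
sumBy-eval F xs r = trans (sumBy-swap (λ x e → proj₁ e * F x (proj₂ e)) xs r)
                          (sumBy-cong r (λ e → sumBy-*ˡ (proj₁ e) (λ x → F x (proj₂ e)) xs))

-- Free zinbiel algebras

module FreeZinbielProperties (S : Set) (_≟S_ : DecidableEquality S) where
  open FreeZinbiel S _≟S_

  eval-• : ∀ f c p → eval f (c • p) ≡ c * eval f p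
  eval-• f c []            = sym (QP.*-zeroʳ c)
  eval-• f c ((d , w) ∷ p) =
    trans (cong₂ _+_ (QP.*-assoc c d (f w)) (eval-• f c p)) (sym (QP.*-distribˡ-+ c _ _))

  eval-≺ : ∀ G p q → eval G (p ≺ q) ≡ eval (λ w → eval (λ w′ → sumBy G (w ≺W w′)) q) p
  eval-≺ G p q =
    trans (sumBy-concatMap _ _ p) (sumBy-cong p (λ { (c , w) →
      trans (sumBy-concatMap _ _ q)
            (trans (sumBy-cong q (λ { (d , w′) → summand c d w w′ }))
                   (sumBy-*ˡ c _ q)) }))
    where
      summand : ∀ c d w w′ →
        eval G (map (λ t → (c * d , t)) (w ≺W w′)) ≡ c * (d * sumBy G (w ≺W w′))
      summand c d w w′ = trans (sumBy-map _ _ (w ≺W w′))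
        (trans (sumBy-*ˡ (c * d) G (w ≺W w′)) (QP.*-assoc c d _))

  eval-≺′ : ∀ G p q → eval G (p ≺ q) ≡ eval (λ w′ → eval (λ w → sumBy G (w ≺W w′)) p) q
  eval-≺′ G p q = trans (eval-≺ G p q) (eval-swap (λ w w′ → sumBy G (w ≺W w′)) p q)

  δ : Word → Word → ℚ
  δ w w′ with w′ ≟W w
  ... | yes _ = 1ℚ
  ... | no  _ = 0ℚ

  δ-refl : ∀ w → δ w w ≡ 1ℚ
  δ-refl w with w ≟W w
  ... | yes _   = refl
  ... | no  w≢w = ⊥-elim (w≢w refl)

  δ-≢ : ∀ {w w′} → w′ ≢ w → δ w w′ ≡ 0ℚ
  δ-≢ {w} {w′} w′≢w with w′ ≟W w
  ... | yes w′≡w = ⊥-elim (w′≢w w′≡w)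
  ... | no  _    = refl

  coeff-eval : ∀ p w → coeff p w ≡ eval (δ w) p
  coeff-eval []             w = refl
  coeff-eval ((c , w′) ∷ p) w with w′ ≟W w
  ... | yes _ = cong₂ _+_ (sym (QP.*-identityʳ c)) (coeff-eval p w)
  ... | no  _ = trans (coeff-eval p w)
                      (sym (trans (cong (_+ _) (QP.*-zeroʳ c)) (QP.+-identityˡ _)))

  _⊖_ : Elt → Elt → Elt
  p ⊖ q = p ⊕ ((- 1ℚ) • q)

  eval-⊖ : ∀ f p q → eval f (p ⊖ q) ≡ eval f p - eval f q
  eval-⊖ f p q = trans (eval-++ f p _)
    (cong (eval f p +_) (trans (eval-• f (- 1ℚ) q) (-1*p≡-p (eval f q))))

  coeff-⊖ : ∀ p q w → coeff (p ⊖ q) w ≡ coeff p w - coeff q w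
  coeff-⊖ p q w = trans (coeff-eval (p ⊖ q) w)
    (trans (eval-⊖ (δ w) p q) (sym (cong₂ _-_ (coeff-eval p w) (coeff-eval q w))))

  erase : Word → Elt → Elt
  erase w [] = []
  erase w ((c , w′) ∷ p) with w′ ≟W w
  ... | yes _ = erase w p
  ... | no  _ = (c , w′) ∷ erase w p

  eval-erase : ∀ f w p → eval f p ≡ coeff p w * f w + eval f (erase w p)
  eval-erase f w [] = sym (trans (cong (_+ 0ℚ) (QP.*-zeroˡ (f w))) (QP.+-identityˡ 0ℚ))
  eval-erase f w ((c , w′) ∷ p) with w′ ≟W w
  ... | yes refl = trans (cong (c * f w +_) (eval-erase f w p)) (begin
        c * f w + (coeff p w * f w + eval f (erase w p))
          ≡⟨ sym (QP.+-assoc (c * f w) _ _) ⟩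
        (c * f w + coeff p w * f w) + eval f (erase w p)
          ≡⟨ cong (_+ eval f (erase w p)) (sym (QP.*-distribʳ-+ (f w) c _)) ⟩
        (c + coeff p w) * f w + eval f (erase w p) ∎)
    where open ≡-Reasoning
  ... | no  _ = trans (cong (c * f w′ +_) (eval-erase f w p)) (+ℚ.x∙yz≈y∙xz (c * f w′) (coeff p w * f w) _)

  coeff-erase-≡ : ∀ w p → coeff (erase w p) w ≡ 0ℚ
  coeff-erase-≡ w [] = refl
  coeff-erase-≡ w ((c , w′) ∷ p) with w′ ≟W w
  ... | yes _ = coeff-erase-≡ w p
  ... | no w′≢w with w′ ≟W w
  ...   | yes w′≡w = ⊥-elim (w′≢w w′≡w)
  ...   | no  _    = coeff-erase-≡ w p

  coeff-erase-≢ : ∀ {w w″} p → w″ ≢ w → coeff (erase w p) w″ ≡ coeff p w″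
  coeff-erase-≢ [] _ = refl
  coeff-erase-≢ {w} {w″} ((c , w′) ∷ p) w″≢w with w′ ≟W w
  ... | no _ = step
    where
      step : coeff ((c , w′) ∷ erase w p) w″ ≡ coeff ((c , w′) ∷ p) w″
      step with w′ ≟W w″
      ... | yes _ = cong (c +_) (coeff-erase-≢ p w″≢w)
      ... | no  _ = coeff-erase-≢ p w″≢w
  ... | yes refl with w′ ≟W w″
  ...   | yes refl = ⊥-elim (w″≢w refl)
  ...   | no  _    = coeff-erase-≢ p w″≢w

  length-erase : ∀ w p → length (erase w p) ℕ.≤ length p
  length-erase w [] = z≤n
  length-erase w ((c , w′) ∷ p) with w′ ≟W w
  ... | yes _ = NP.m≤n⇒m≤1+n (length-erase w p)
  ... | no  _ = s≤s (length-erase w p)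

  length-erase-head : ∀ c w p → length (erase w ((c , w) ∷ p)) ℕ.< suc (length p)
  length-erase-head c w p with w ≟W w
  ... | yes _   = s≤s (length-erase w p)
  ... | no  w≢w = ⊥-elim (w≢w refl)

  eval-vanish : ∀ {f} p → (∀ w → coeff p w ≡ 0ℚ ⊎ f w ≡ 0ℚ) → eval f p ≡ 0ℚ
  eval-vanish p = go p (<-wellFounded (length p))
    where
      go : ∀ {f} p → Acc ℕ._<_ (length p) → (∀ w → coeff p w ≡ 0ℚ ⊎ f w ≡ 0ℚ) → eval f p ≡ 0ℚ
      go []                  _         _        = refl
      go {f} p@((c , w) ∷ _) (acc rec) vanishes = begin
        eval f p                              ≡⟨ eval-erase f w p ⟩
        coeff p w * f w + eval f (erase w p)  ≡⟨ cong₂ _+_ (*-≡0 (vanishes w)) erased-vanishes ⟩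
        0ℚ + 0ℚ                               ≡⟨ QP.+-identityˡ 0ℚ ⟩
        0ℚ                                    ∎
        where
          open ≡-Reasoning
          vanishes′ : ∀ w′ → coeff (erase w p) w′ ≡ 0ℚ ⊎ f w′ ≡ 0ℚ
          vanishes′ w′ with w′ ≟W w
          ... | yes refl = inj₁ (coeff-erase-≡ w p)
          ... | no w′≢w  = Sum.map₁ (trans (coeff-erase-≢ p w′≢w)) (vanishes w′)
          erased-vanishes = go (erase w p) (rec (length-erase-head c w _)) vanishes′

  eval-concentrated : ∀ {f} p w → (∀ w′ → w′ ≢ w → coeff p w′ ≡ 0ℚ ⊎ f w′ ≡ 0ℚ) →
                      eval f p ≡ coeff p w * f w
  eval-concentrated {f} p w vanishes =
    trans (eval-erase f w p)
          (trans (cong (coeff p w * f w +_) (eval-vanish (erase w p) vanishes′))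
                 (QP.+-identityʳ _))
    where
      vanishes′ : ∀ w′ → coeff (erase w p) w′ ≡ 0ℚ ⊎ f w′ ≡ 0ℚ
      vanishes′ w′ with w′ ≟W w
      ... | yes refl = inj₁ (coeff-erase-≡ w p)
      ... | no w′≢w  = Sum.map₁ (trans (coeff-erase-≢ p w′≢w)) (vanishes w′ w′≢w)

  coeff-≢0⇒∈ : ∀ p {w} → coeff p w ≢ 0ℚ → w ∈ map proj₂ p
  coeff-≢0⇒∈ []             coeff≢0 = ⊥-elim (coeff≢0 refl)
  coeff-≢0⇒∈ ((c , w′) ∷ p) {w} coeff≢0 with w′ ≟W w
  ... | yes refl = here refl
  ... | no  _    = there (coeff-≢0⇒∈ p coeff≢0)

  -- Unlike ≈, agreement under all linear functionals is visibly a congruence for ≺.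
  _≐_ : Elt → Elt → Set
  p ≐ q = ∀ f → eval f p ≡ eval f q

  ≐⇒≈ : ∀ {p q} → p ≐ q → p ≈ q
  ≐⇒≈ {p} {q} p≐q w = trans (coeff-eval p w) (trans (p≐q (δ w)) (sym (coeff-eval q w)))

  ≈⇒≐ : ∀ {p q} → p ≈ q → p ≐ q
  ≈⇒≐ {p} {q} p≈q f = x∙y⁻¹≈ε⇒x≈y _ _
    (trans (sym (eval-⊖ f p q)) (eval-vanish (p ⊖ q) (λ w → inj₁ (coeff-⊖-≡ w))))
    where
      coeff-⊖-≡ : ∀ w → coeff (p ⊖ q) w ≡ 0ℚ
      coeff-⊖-≡ w = trans (coeff-⊖ p q w) (trans (cong (_- coeff q w) (p≈q w)) (QP.+-inverseʳ (coeff q w)))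

  δ-nonneg : ∀ w w′ → 0ℚ ≤ δ w w′
  δ-nonneg w w′ with w′ ≟W w
  ... | yes _ = QP.nonNegative⁻¹ 1ℚ
  ... | no  _ = QP.≤-refl

  sumBy-δ-nonneg : ∀ w ws → 0ℚ ≤ sumBy (δ w) ws
  sumBy-δ-nonneg w []       = QP.≤-refl
  sumBy-δ-nonneg w (x ∷ ws) = QP.+-mono-≤ (δ-nonneg w x) (sumBy-δ-nonneg w ws)

  sumBy-δ-∈ : ∀ {w ws} → w ∈ ws → sumBy (δ w) ws ≢ 0ℚ
  sumBy-δ-∈ {w} w∈ws sum≡0 =
    QP.1≢0 (QP.≤-antisym (subst (1ℚ ≤_) sum≡0 (1≤sum w∈ws)) (QP.nonNegative⁻¹ 1ℚ))
    where
      1≤sum : ∀ {ws} → w ∈ ws → 1ℚ ≤ sumBy (δ w) ws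
      1≤sum {_ ∷ ws} (here refl) = subst (_≤ δ w w + sumBy (δ w) ws) (QP.+-identityʳ 1ℚ)
        (QP.+-mono-≤ (QP.≤-reflexive (sym (δ-refl w))) (sumBy-δ-nonneg w ws))
      1≤sum {x ∷ ws} (there w∈ws) = subst (_≤ δ w x + sumBy (δ w) ws) (QP.+-identityˡ 1ℚ)
        (QP.+-mono-≤ (δ-nonneg w x) (1≤sum w∈ws))

  shuffles-[]ʳ : ∀ s → shuffles s [] ≡ s ∷ []
  shuffles-[]ʳ []      = refl
  shuffles-[]ʳ (a ∷ s) = refl

  sumBy-shuffles-∷ : ∀ (G : List S → ℚ) a t b y →
    sumBy G (shuffles (a ∷ t) (b ∷ y)) ≡
    sumBy (G ∘ (a ∷_)) (shuffles t (b ∷ y)) + sumBy (G ∘ (b ∷_)) (shuffles (a ∷ t) y)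
  sumBy-shuffles-∷ G a t b y =
    trans (sumBy-++ G (map (a ∷_) (shuffles t (b ∷ y))) (map (b ∷_) (shuffles (a ∷ t) y)))
          (cong₂ _+_ (sumBy-map G (a ∷_) (shuffles t (b ∷ y))) (sumBy-map G (b ∷_) (shuffles (a ∷ t) y)))

  sumBy-shuffles-comm : ∀ (G : List S → ℚ) t y → sumBy G (shuffles t y) ≡ sumBy G (shuffles y t)
  sumBy-shuffles-comm G []      y       = cong (sumBy G) (sym (shuffles-[]ʳ y))
  sumBy-shuffles-comm G (a ∷ t) []      = refl
  sumBy-shuffles-comm G (a ∷ t) (b ∷ y) = begin
    sumBy G (shuffles (a ∷ t) (b ∷ y))
      ≡⟨ sumBy-shuffles-∷ G a t b y ⟩
    sumBy (G ∘ (a ∷_)) (shuffles t (b ∷ y)) + sumBy (G ∘ (b ∷_)) (shuffles (a ∷ t) y)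
      ≡⟨ cong₂ _+_ (sumBy-shuffles-comm (G ∘ (a ∷_)) t (b ∷ y)) (sumBy-shuffles-comm (G ∘ (b ∷_)) (a ∷ t) y) ⟩
    sumBy (G ∘ (a ∷_)) (shuffles (b ∷ y) t) + sumBy (G ∘ (b ∷_)) (shuffles y (a ∷ t))
      ≡⟨ QP.+-comm (sumBy (G ∘ (a ∷_)) (shuffles (b ∷ y) t)) _ ⟩
    sumBy (G ∘ (b ∷_)) (shuffles y (a ∷ t)) + sumBy (G ∘ (a ∷_)) (shuffles (b ∷ y) t)
      ≡⟨ sym (sumBy-shuffles-∷ G b y a t) ⟩
    sumBy G (shuffles (b ∷ y) (a ∷ t)) ∎
    where open ≡-Reasoning

  ++∈shuffles : ∀ t y → t ++ y ∈ shuffles t y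
  ++∈shuffles []      y       = here refl
  ++∈shuffles (a ∷ t) []      = here (cong (a ∷_) (LP.++-identityʳ t))
  ++∈shuffles (a ∷ t) (b ∷ y) = AnyP.++⁺ˡ (∈-map⁺ (a ∷_) (++∈shuffles t (b ∷ y)))

  shuffle³ˡ shuffle³ʳ : (List S → ℚ) → List S → List S → List S → ℚ
  shuffle³ˡ G t y z = sumBy (λ s → sumBy G (shuffles s z)) (shuffles t y)
  shuffle³ʳ G t y z = sumBy (λ r → sumBy G (shuffles t r)) (shuffles y z)

  shuffle³ˡ-∷ : ∀ G a t b y c z →
    shuffle³ˡ G (a ∷ t) (b ∷ y) (c ∷ z) ≡
      (shuffle³ˡ (G ∘ (a ∷_)) t (b ∷ y) (c ∷ z) + shuffle³ˡ (G ∘ (b ∷_)) (a ∷ t) y (c ∷ z))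
      + shuffle³ˡ (G ∘ (c ∷_)) (a ∷ t) (b ∷ y) z
  shuffle³ˡ-∷ G a t b y c z = begin
    shuffle³ˡ G (a ∷ t) (b ∷ y) (c ∷ z)
      ≡⟨ sumBy-shuffles-∷ (λ s → sumBy G (shuffles s (c ∷ z))) a t b y ⟩
    sumBy (λ s → sumBy G (shuffles (a ∷ s) (c ∷ z))) (shuffles t (b ∷ y)) +
    sumBy (λ s → sumBy G (shuffles (b ∷ s) (c ∷ z))) (shuffles (a ∷ t) y)
      ≡⟨ cong₂ _+_ (expand a (shuffles t (b ∷ y))) (expand b (shuffles (a ∷ t) y)) ⟩
    (Xa + Za) + (Xb + Zb)
      ≡⟨ +ℚ.interchange Xa Za Xb Zb ⟩
    (Xa + Xb) + (Za + Zb)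
      ≡⟨ cong ((Xa + Xb) +_) (sym (sumBy-shuffles-∷ (λ s → sumBy (G ∘ (c ∷_)) (shuffles s z)) a t b y)) ⟩
    (Xa + Xb) + shuffle³ˡ (G ∘ (c ∷_)) (a ∷ t) (b ∷ y) z ∎
    where
      open ≡-Reasoning
      expand : ∀ d ss → sumBy (λ s → sumBy G (shuffles (d ∷ s) (c ∷ z))) ss ≡
        sumBy (λ s → sumBy (G ∘ (d ∷_)) (shuffles s (c ∷ z))) ss +
        sumBy (λ s → sumBy (G ∘ (c ∷_)) (shuffles (d ∷ s) z)) ss
      expand d ss = trans (sumBy-cong ss (λ s → sumBy-shuffles-∷ G d s c z)) (sumBy-+ _ _ ss)
      Xa = shuffle³ˡ (G ∘ (a ∷_)) t (b ∷ y) (c ∷ z)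
      Xb = shuffle³ˡ (G ∘ (b ∷_)) (a ∷ t) y (c ∷ z)
      Za = sumBy (λ s → sumBy (G ∘ (c ∷_)) (shuffles (a ∷ s) z)) (shuffles t (b ∷ y))
      Zb = sumBy (λ s → sumBy (G ∘ (c ∷_)) (shuffles (b ∷ s) z)) (shuffles (a ∷ t) y)

  shuffle³ʳ-∷ : ∀ G a t b y c z →
    shuffle³ʳ G (a ∷ t) (b ∷ y) (c ∷ z) ≡
      (shuffle³ʳ (G ∘ (a ∷_)) t (b ∷ y) (c ∷ z) + shuffle³ʳ (G ∘ (b ∷_)) (a ∷ t) y (c ∷ z))
      + shuffle³ʳ (G ∘ (c ∷_)) (a ∷ t) (b ∷ y) z
  shuffle³ʳ-∷ G a t b y c z = begin
    shuffle³ʳ G (a ∷ t) (b ∷ y) (c ∷ z)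
      ≡⟨ sumBy-shuffles-∷ (λ r → sumBy G (shuffles (a ∷ t) r)) b y c z ⟩
    sumBy (λ r → sumBy G (shuffles (a ∷ t) (b ∷ r))) (shuffles y (c ∷ z)) +
    sumBy (λ r → sumBy G (shuffles (a ∷ t) (c ∷ r))) (shuffles (b ∷ y) z)
      ≡⟨ cong₂ _+_ (expand b (shuffles y (c ∷ z))) (expand c (shuffles (b ∷ y) z)) ⟩
    (Ab + Xb) + (Ac + Xc)
      ≡⟨ +ℚ.interchange Ab Xb Ac Xc ⟩
    (Ab + Ac) + (Xb + Xc)
      ≡⟨ sym (QP.+-assoc (Ab + Ac) Xb Xc) ⟩
    ((Ab + Ac) + Xb) + Xc
      ≡⟨ cong (λ x → (x + Xb) + Xc) (sym (sumBy-shuffles-∷ (λ r → sumBy (G ∘ (a ∷_)) (shuffles t r)) b y c z)) ⟩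
    (shuffle³ʳ (G ∘ (a ∷_)) t (b ∷ y) (c ∷ z) + Xb) + Xc ∎
    where
      open ≡-Reasoning
      expand : ∀ d rs → sumBy (λ r → sumBy G (shuffles (a ∷ t) (d ∷ r))) rs ≡
        sumBy (λ r → sumBy (G ∘ (a ∷_)) (shuffles t (d ∷ r))) rs +
        sumBy (λ r → sumBy (G ∘ (d ∷_)) (shuffles (a ∷ t) r)) rs
      expand d rs = trans (sumBy-cong rs (λ r → sumBy-shuffles-∷ G a t d r)) (sumBy-+ _ _ rs)
      Ab = sumBy (λ r → sumBy (G ∘ (a ∷_)) (shuffles t (b ∷ r))) (shuffles y (c ∷ z))
      Ac = sumBy (λ r → sumBy (G ∘ (a ∷_)) (shuffles t (c ∷ r))) (shuffles (b ∷ y) z)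
      Xb = shuffle³ʳ (G ∘ (b ∷_)) (a ∷ t) y (c ∷ z)
      Xc = shuffle³ʳ (G ∘ (c ∷_)) (a ∷ t) (b ∷ y) z

  shuffle³-assoc : ∀ G t y z → shuffle³ˡ G t y z ≡ shuffle³ʳ G t y z
  shuffle³-assoc G []      y       z       =
    trans (QP.+-identityʳ _) (sym (sumBy-cong (shuffles y z) (λ r → QP.+-identityʳ (G r))))
  shuffle³-assoc G (a ∷ t) []      z       = refl
  shuffle³-assoc G (a ∷ t) (b ∷ y) []      =
    trans (sumBy-cong (shuffles (a ∷ t) (b ∷ y))
                      (λ s → trans (cong (sumBy G) (shuffles-[]ʳ s)) (QP.+-identityʳ (G s))))
          (sym (QP.+-identityʳ _))
  shuffle³-assoc G (a ∷ t) (b ∷ y) (c ∷ z) =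
    trans (shuffle³ˡ-∷ G a t b y c z)
     (trans (cong₂ _+_ (cong₂ _+_ (shuffle³-assoc (G ∘ (a ∷_)) t (b ∷ y) (c ∷ z))
                                  (shuffle³-assoc (G ∘ (b ∷_)) (a ∷ t) y (c ∷ z)))
                       (shuffle³-assoc (G ∘ (c ∷_)) (a ∷ t) (b ∷ y) z))
            (sym (shuffle³ʳ-∷ G a t b y c z)))

  sumBy-≺W-zinbiel : ∀ G w w′ w″ →
    sumBy (λ y → sumBy G (y ≺W w″)) (w ≺W w′) ≡
    sumBy (λ y → sumBy G (w ≺W y)) (w′ ≺W w″) + sumBy (λ y → sumBy G (w ≺W y)) (w″ ≺W w′)
  sumBy-≺W-zinbiel G (a , t) (b , t′) (c , t″) = begin
    sumBy (λ y → sumBy G (y ≺W (c , t″))) (map (a ,_) (shuffles t (b ∷ t′)))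
      ≡⟨ sumBy-map _ (a ,_) (shuffles t (b ∷ t′)) ⟩
    sumBy (λ s → sumBy G (map (a ,_) (shuffles s (c ∷ t″)))) (shuffles t (b ∷ t′))
      ≡⟨ sumBy-cong (shuffles t (b ∷ t′)) (λ s → sumBy-map G (a ,_) (shuffles s (c ∷ t″))) ⟩
    shuffle³ˡ Gₐ t (b ∷ t′) (c ∷ t″)
      ≡⟨ shuffle³-assoc Gₐ t (b ∷ t′) (c ∷ t″) ⟩
    shuffle³ʳ Gₐ t (b ∷ t′) (c ∷ t″)
      ≡⟨ sumBy-shuffles-∷ (λ r → sumBy Gₐ (shuffles t r)) b t′ c t″ ⟩
    sumBy (λ r → sumBy Gₐ (shuffles t (b ∷ r))) (shuffles t′ (c ∷ t″)) +
    sumBy (λ r → sumBy Gₐ (shuffles t (c ∷ r))) (shuffles (b ∷ t′) t″)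
      ≡⟨ cong₂ _+_ (sym (unfold b t′ c t″))
                   (trans (sumBy-shuffles-comm (λ r → sumBy Gₐ (shuffles t (c ∷ r))) (b ∷ t′) t″)
                          (sym (unfold c t″ b t′))) ⟩
    sumBy (λ y → sumBy G ((a , t) ≺W y)) ((b , t′) ≺W (c , t″)) +
    sumBy (λ y → sumBy G ((a , t) ≺W y)) ((c , t″) ≺W (b , t′)) ∎
    where
      open ≡-Reasoning
      Gₐ = G ∘ (a ,_)
      unfold : ∀ b t′ c t″ → sumBy (λ y → sumBy G ((a , t) ≺W y)) ((b , t′) ≺W (c , t″)) ≡
                            sumBy (λ r → sumBy Gₐ (shuffles t (b ∷ r))) (shuffles t′ (c ∷ t″))
      unfold b t′ c t″ = trans (sumBy-map _ (b ,_) (shuffles t′ (c ∷ t″)))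
        (sumBy-cong (shuffles t′ (c ∷ t″)) (λ s → sumBy-map G (a ,_) (shuffles t (b ∷ s))))

  zinbiel : ∀ p q r → ((p ≺ q) ≺ r) ≐ (p ≺ ((q ≺ r) ⊕ (r ≺ q)))
  zinbiel p q r G = begin
    eval G ((p ≺ q) ≺ r)
      ≡⟨ eval-≺ G (p ≺ q) r ⟩
    eval K (p ≺ q)
      ≡⟨ eval-≺ K p q ⟩
    eval (λ w → eval (λ w′ → sumBy K (w ≺W w′)) q) p
      ≡⟨ eval-cong p (λ w → eval-cong q (λ w′ → sumBy-eval (λ y w″ → sumBy G (y ≺W w″)) (w ≺W w′) r)) ⟩
    eval (λ w → eval (λ w′ → eval (λ w″ → sumBy (λ y → sumBy G (y ≺W w″)) (w ≺W w′)) r) q) p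
      ≡⟨ eval-cong p (λ w → eval-cong q (λ w′ → eval-cong r (λ w″ → sumBy-≺W-zinbiel G w w′ w″))) ⟩
    eval (λ w → eval (λ w′ → eval (λ w″ → H w w′ w″ + H w w″ w′) r) q) p
      ≡⟨ eval-cong p split ⟩
    eval (λ w → eval (Gʷ w) (q ≺ r) + eval (Gʷ w) (r ≺ q)) p
      ≡⟨ eval-cong p (λ w → sym (eval-++ (Gʷ w) (q ≺ r) (r ≺ q))) ⟩
    eval (λ w → eval (Gʷ w) ((q ≺ r) ⊕ (r ≺ q))) p
      ≡⟨ sym (eval-≺ G p ((q ≺ r) ⊕ (r ≺ q))) ⟩
    eval G (p ≺ ((q ≺ r) ⊕ (r ≺ q))) ∎
    where
      open ≡-Reasoning
      K  = λ y → eval (λ w″ → sumBy G (y ≺W w″)) r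
      Gʷ = λ w y → sumBy G (w ≺W y)
      H  = λ w w′ w″ → sumBy (Gʷ w) (w′ ≺W w″)
      split : ∀ w → eval (λ w′ → eval (λ w″ → H w w′ w″ + H w w″ w′) r) q ≡
                    eval (Gʷ w) (q ≺ r) + eval (Gʷ w) (r ≺ q)
      split w = begin
        eval (λ w′ → eval (λ w″ → H w w′ w″ + H w w″ w′) r) q
          ≡⟨ eval-cong q (λ w′ → eval-+ (H w w′) (λ w″ → H w w″ w′) r) ⟩
        eval (λ w′ → eval (H w w′) r + eval (λ w″ → H w w″ w′) r) q
          ≡⟨ eval-+ _ _ q ⟩
        eval (λ w′ → eval (H w w′) r) q + eval (λ w′ → eval (λ w″ → H w w″ w′) r) q
          ≡⟨ cong (eval (λ w′ → eval (H w w′) r) q +_) (eval-swap (λ w′ w″ → H w w″ w′) q r) ⟩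
        eval (λ w′ → eval (H w w′) r) q + eval (λ w″ → eval (H w w″) q) r
          ≡⟨ cong₂ _+_ (sym (eval-≺ (Gʷ w) q r)) (sym (eval-≺ (Gʷ w) r q)) ⟩
        eval (Gʷ w) (q ≺ r) + eval (Gʷ w) (r ≺ q) ∎

  ≺-cong : ∀ {p p′ q q′} → p ≐ p′ → q ≐ q′ → (p ≺ q) ≐ (p′ ≺ q′)
  ≺-cong {p} {p′} {q} {q′} p≐p′ q≐q′ G =
    trans (eval-≺ G p q) (trans (p≐p′ _) (trans (eval-cong p′ (λ w → q≐q′ _)) (sym (eval-≺ G p′ q′))))

-- The morphism φ

module ZA = FreeZinbielProperties (Fin 2) FinP._≟_
module ZX = FreeZinbielProperties Gen _≟G_

open ZA using (_≐_)

module Morphism (u v : ℚ) where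

  φw : WordX → EltA
  φw (a , t) = φword′ u v a t

  eval-φ : ∀ G p → eval G (φ u v p) ≡ eval (λ w → eval G (φw w)) p
  eval-φ G []                 = refl
  eval-φ G ((c , (a , t)) ∷ p) = trans (eval-++ G (c •A φword′ u v a t) (φ u v p))
    (cong₂ _+_ (ZA.eval-• G c (φword′ u v a t)) (eval-φ G p))

  -- Induction on total length: the zinbiel identity (g ≺ P) ≺ Q = g ≺ (P ≺ Q + Q ≺ P)
  -- matches splitting a shuffle according to its second letter.
  eval-φ-≺WX : ∀ n G t t′ a b → length t ℕ.+ length t′ ≡ n →
    sumBy (eval G ∘ φw) ((a , t) ≺WX (b , t′)) ≡ eval G (φw (a , t) ≺A φw (b , t′))
  eval-φ-≺WX n       G []       t′ a b _   = QP.+-identityʳ _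
  eval-φ-≺WX (suc n) G (c ∷ t₀) t′ a b len = begin
    sumBy F (map (a ,_) (shufflesX (c ∷ t₀) (b ∷ t′)))
      ≡⟨ sumBy-map F (a ,_) (shufflesX (c ∷ t₀) (b ∷ t′)) ⟩
    sumBy (F ∘ (a ,_)) (shufflesX (c ∷ t₀) (b ∷ t′))
      ≡⟨ ZX.sumBy-shuffles-∷ (F ∘ (a ,_)) c t₀ b t′ ⟩
    sumBy (λ s → F (a , c ∷ s)) (shufflesX t₀ (b ∷ t′)) + sumBy (λ s → F (a , b ∷ s)) (shufflesX (c ∷ t₀) t′)
      ≡⟨ cong₂ _+_ (sumBy-cong (shufflesX t₀ (b ∷ t′)) (λ s → ZA.eval-≺′ G g (φw (c , s))))
                   (trans (sumBy-cong (shufflesX (c ∷ t₀) t′) (λ s → ZA.eval-≺′ G g (φw (b , s))))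
                          (ZX.sumBy-shuffles-comm (λ s → eval Gᵍ (φw (b , s))) (c ∷ t₀) t′)) ⟩
    sumBy (λ s → eval Gᵍ (φw (c , s))) (shufflesX t₀ (b ∷ t′)) +
    sumBy (λ s → eval Gᵍ (φw (b , s))) (shufflesX t′ (c ∷ t₀))
      ≡⟨ cong₂ _+_ (sym (sumBy-map (eval Gᵍ ∘ φw) (c ,_) (shufflesX t₀ (b ∷ t′))))
                   (sym (sumBy-map (eval Gᵍ ∘ φw) (b ,_) (shufflesX t′ (c ∷ t₀)))) ⟩
    sumBy (eval Gᵍ ∘ φw) ((c , t₀) ≺WX (b , t′)) + sumBy (eval Gᵍ ∘ φw) ((b , t′) ≺WX (c , t₀))
      ≡⟨ cong₂ _+_ (eval-φ-≺WX n Gᵍ t₀ t′ c b (NP.suc-injective len))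
                   (eval-φ-≺WX n Gᵍ t′ t₀ b c (trans (NP.+-comm (length t′) _) (NP.suc-injective len))) ⟩
    eval Gᵍ (P ≺A Q) + eval Gᵍ (Q ≺A P)
      ≡⟨ sym (eval-++ Gᵍ (P ≺A Q) (Q ≺A P)) ⟩
    eval Gᵍ ((P ≺A Q) ⊕A (Q ≺A P))
      ≡⟨ sym (ZA.eval-≺′ G g ((P ≺A Q) ⊕A (Q ≺A P))) ⟩
    eval G (g ≺A ((P ≺A Q) ⊕A (Q ≺A P)))
      ≡⟨ sym (ZA.zinbiel g P Q G) ⟩
    eval G ((g ≺A P) ≺A Q) ∎
    where
      open ≡-Reasoning
      F  = eval G ∘ φw
      g  = φgen u v a
      P  = φw (c , t₀)
      Q  = φw (b , t′)
      Gᵍ = λ y′ → eval (λ y → sumBy G (y ≺WA y′)) g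

  φ-≺ : ∀ p q → φ u v (p ≺X q) ≐ (φ u v p ≺A φ u v q)
  φ-≺ p q G = begin
    eval G (φ u v (p ≺X q))
      ≡⟨ eval-φ G (p ≺X q) ⟩
    eval (eval G ∘ φw) (p ≺X q)
      ≡⟨ ZX.eval-≺ (eval G ∘ φw) p q ⟩
    eval (λ w → eval (λ w′ → sumBy (eval G ∘ φw) (w ≺WX w′)) q) p
      ≡⟨ eval-cong p (λ w → eval-cong q (λ w′ → eval-φ-≺WX _ G (proj₂ w) (proj₂ w′) (proj₁ w) (proj₁ w′) refl)) ⟩
    eval (λ w → eval (λ w′ → eval G (φw w ≺A φw w′)) q) p
      ≡⟨ eval-cong p (λ w → eval-cong q (λ w′ → ZA.eval-≺ G (φw w) (φw w′))) ⟩
    eval (λ w → eval (λ w′ → eval (λ y → eval (Gʸ y) (φw w′)) (φw w)) q) p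
      ≡⟨ eval-cong p (λ w → swap (φw w) q) ⟩
    eval (λ w → eval (λ y → eval (λ w′ → eval (Gʸ y) (φw w′)) q) (φw w)) p
      ≡⟨ sym (eval-φ _ p) ⟩
    eval (λ y → eval (λ w′ → eval (Gʸ y) (φw w′)) q) (φ u v p)
      ≡⟨ sym (eval-cong (φ u v p) (λ y → eval-φ (Gʸ y) q)) ⟩
    eval (λ y → eval (Gʸ y) (φ u v q)) (φ u v p)
      ≡⟨ sym (ZA.eval-≺ G (φ u v p) (φ u v q)) ⟩
    eval G (φ u v p ≺A φ u v q) ∎
    where
      open ≡-Reasoning
      Gʸ = λ y y′ → sumBy G (y ≺WA y′)
      swap : ∀ e q → eval (λ w′ → eval (λ y → eval (Gʸ y) (φw w′)) e) q ≡
                     eval (λ y → eval (λ w′ → eval (Gʸ y) (φw w′)) q) e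
      swap e q = eval-swap (λ w′ y → eval (Gʸ y) (φw w′)) q e

  φ-cong : ∀ p q → p ≈X q → φ u v p ≈A φ u v q
  φ-cong p q p≈q = ZA.≐⇒≈ {φ u v p} {φ u v q} λ G →
    trans (eval-φ G p) (trans (ZX.≈⇒≐ {p} {q} p≈q (eval G ∘ φw)) (sym (eval-φ G q)))

  φ-InC : ∀ p → InC u v (φ u v p)
  φ-InC []                 = czero
  φ-InC ((c , (a , t)) ∷ p) = cadd (cscal c (word-InC a t)) (φ-InC p)
    where
      gen-InC : ∀ a → InC u v (φgen u v a)
      gen-InC x₂ = gen₂
      gen-InC x₃ = gen₃
      word-InC : ∀ a t → InC u v (φword′ u v a t)
      word-InC a []      = gen-InC a
      word-InC a (b ∷ t) = cprod (gen-InC a) (word-InC b t)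

  φ-wordX : ∀ a → φ u v (wordX (a , [])) ≐ φgen u v a
  φ-wordX a G = trans (eval-φ G (wordX (a , []))) (trans (QP.+-identityʳ _) (QP.*-identityˡ _))

  InC⇒image : ∀ {e} → InC u v e → ∃ λ p → φ u v p ≐ e
  InC⇒image gen₂ = wordX (x₂ , []) , φ-wordX x₂
  InC⇒image gen₃ = wordX (x₃ , []) , φ-wordX x₃
  InC⇒image czero = [] , λ G → refl
  InC⇒image (cadd {a} {b} a∈C b∈C) with InC⇒image a∈C | InC⇒image b∈C
  ... | p , φp≐a | q , φq≐b = p ⊕X q , λ G → begin
    eval G (φ u v (p ⊕X q))                          ≡⟨ eval-φ G (p ⊕X q) ⟩
    eval (eval G ∘ φw) (p ⊕X q)                      ≡⟨ eval-++ _ p q ⟩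
    eval (eval G ∘ φw) p + eval (eval G ∘ φw) q      ≡⟨ cong₂ _+_ (sym (eval-φ G p)) (sym (eval-φ G q)) ⟩
    eval G (φ u v p) + eval G (φ u v q)              ≡⟨ cong₂ _+_ (φp≐a G) (φq≐b G) ⟩
    eval G a + eval G b                              ≡⟨ sym (eval-++ G a b) ⟩
    eval G (a ⊕A b)                                  ∎
    where open ≡-Reasoning
  InC⇒image (cscal c {a} a∈C) with InC⇒image a∈C
  ... | p , φp≐a = c •X p , λ G → begin
    eval G (φ u v (c •X p))         ≡⟨ eval-φ G (c •X p) ⟩
    eval (eval G ∘ φw) (c •X p)     ≡⟨ ZX.eval-• _ c p ⟩
    c * eval (eval G ∘ φw) p        ≡⟨ cong (c *_) (trans (sym (eval-φ G p)) (φp≐a G)) ⟩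
    c * eval G a                    ≡⟨ sym (ZA.eval-• G c a) ⟩
    eval G (c •A a)                 ∎
    where open ≡-Reasoning
  InC⇒image (cprod {a} {b} a∈C b∈C) with InC⇒image a∈C | InC⇒image b∈C
  ... | p , φp≐a | q , φq≐b =
    p ≺X q , λ G → trans (φ-≺ p q G) (ZA.≺-cong {φ u v p} {a} {φ u v q} {b} φp≐a φq≐b G)
  InC⇒image (cresp {a} {b} a≈b a∈C) with InC⇒image a∈C
  ... | p , φp≐a = p , λ G → trans (φp≐a G) (ZA.≈⇒≐ {a} {b} a≈b G)

-- Leading words

Tail : Set
Tail = List (Fin 2)

infix 4 _⊴_ _⊑_

data _⊴_ : Tail → Tail → Set where
  []  : [] ⊴ []
  1<0 : ∀ {x y} → length x ≡ length y → l1 ∷ x ⊴ l0 ∷ y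
  _∷_ : ∀ a {x y} → x ⊴ y → a ∷ x ⊴ a ∷ y

⊴-length : ∀ {x y} → x ⊴ y → length x ≡ length y
⊴-length []        = refl
⊴-length (1<0 eq)  = cong suc eq
⊴-length (a ∷ x⊴y) = cong suc (⊴-length x⊴y)

⊴-refl : ∀ x → x ⊴ x
⊴-refl []      = []
⊴-refl (a ∷ x) = a ∷ ⊴-refl x

⊴-trans : ∀ {x y z} → x ⊴ y → y ⊴ z → x ⊴ z
⊴-trans []        []        = []
⊴-trans (1<0 eq)  (_ ∷ y⊴z) = 1<0 (trans eq (⊴-length y⊴z))
⊴-trans (_ ∷ x⊴y) (1<0 eq)  = 1<0 (trans (⊴-length x⊴y) eq)
⊴-trans (a ∷ x⊴y) (_ ∷ y⊴z) = a ∷ ⊴-trans x⊴y y⊴z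

⊴-antisym : ∀ {x y} → x ⊴ y → y ⊴ x → x ≡ y
⊴-antisym []        []        = refl
⊴-antisym (a ∷ x⊴y) (_ ∷ y⊴x) = cong (a ∷_) (⊴-antisym x⊴y y⊴x)

⊴-total : ∀ x y → length x ≡ length y → x ⊴ y ⊎ y ⊴ x
⊴-total []             []             _  = inj₁ []
⊴-total (zero ∷ x)     (zero ∷ y)     eq = Sum.map (l0 ∷_) (l0 ∷_) (⊴-total x y (NP.suc-injective eq))
⊴-total (zero ∷ x)     (suc zero ∷ y) eq = inj₂ (1<0 (sym (NP.suc-injective eq)))
⊴-total (suc zero ∷ x) (zero ∷ y)     eq = inj₁ (1<0 (NP.suc-injective eq))
⊴-total (suc zero ∷ x) (suc zero ∷ y) eq = Sum.map (l1 ∷_) (l1 ∷_) (⊴-total x y (NP.suc-injective eq))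

⊴-++ˡ : ∀ t {x y} → x ⊴ y → t ++ x ⊴ t ++ y
⊴-++ˡ []      x⊴y = x⊴y
⊴-++ˡ (a ∷ t) x⊴y = a ∷ ⊴-++ˡ t x⊴y

_⊑_ : Tail → Tail → Set
x ⊑ y = length x ℕ.< length y ⊎ x ⊴ y

⊑-totalOrder : TotalOrder _ _ _
⊑-totalOrder = record
  { Carrier      = Tail
  ; _≈_          = _≡_
  ; _≤_          = _⊑_
  ; isTotalOrder = record
    { isPartialOrder = record
      { isPreorder = record
        { isEquivalence = isEquivalence
        ; reflexive     = λ { refl → inj₂ (⊴-refl _) }
        ; trans         = ⊑-trans
        }
      ; antisym = ⊑-antisym
      }
    ; total = ⊑-total
    }
  }
  where
    ⊑-trans : ∀ {x y z} → x ⊑ y → y ⊑ z → x ⊑ z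
    ⊑-trans (inj₁ x<y) (inj₁ y<z) = inj₁ (NP.<-trans x<y y<z)
    ⊑-trans (inj₁ x<y) (inj₂ y⊴z) = inj₁ (subst (_ ℕ.<_) (⊴-length y⊴z) x<y)
    ⊑-trans (inj₂ x⊴y) (inj₁ y<z) = inj₁ (subst (ℕ._< _) (sym (⊴-length x⊴y)) y<z)
    ⊑-trans (inj₂ x⊴y) (inj₂ y⊴z) = inj₂ (⊴-trans x⊴y y⊴z)
    ⊑-antisym : ∀ {x y} → x ⊑ y → y ⊑ x → x ≡ y
    ⊑-antisym (inj₁ x<y) (inj₁ y<x) = ⊥-elim (NP.<-asym x<y y<x)
    ⊑-antisym (inj₁ x<y) (inj₂ y⊴x) = ⊥-elim (NP.<-irrefl (sym (⊴-length y⊴x)) x<y)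
    ⊑-antisym (inj₂ x⊴y) (inj₁ y<x) = ⊥-elim (NP.<-irrefl (sym (⊴-length x⊴y)) y<x)
    ⊑-antisym (inj₂ x⊴y) (inj₂ y⊴x) = ⊴-antisym x⊴y y⊴x
    ⊑-total : ∀ x y → x ⊑ y ⊎ y ⊑ x
    ⊑-total x y with NP.<-cmp (length x) (length y)
    ... | tri< x<y _ _ = inj₁ (inj₁ x<y)
    ... | tri≈ _ eq _  = Sum.map inj₂ inj₂ (⊴-total x y eq)
    ... | tri> _ _ y<x = inj₂ (inj₁ y<x)

infix 4 _⊴_⟨≡⇒_⟩

_⊴_⟨≡⇒_⟩ : Tail → Tail → Set → Set
s ⊴ m ⟨≡⇒ P ⟩ = s ⊴ m × (s ≡ m → P)

∷⁺ : ∀ a {s m P} → s ⊴ m ⟨≡⇒ P ⟩ → a ∷ s ⊴ a ∷ m ⟨≡⇒ P ⟩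
∷⁺ a (s⊴m , reach) = a ∷ s⊴m , reach ∘ LP.∷-injectiveʳ

1∷-⊴-0∷ : ∀ {s m P} → length s ≡ length m → l1 ∷ s ⊴ l0 ∷ m ⟨≡⇒ P ⟩
1∷-⊴-0∷ eq = 1<0 eq , λ ()

shuffles-length : ∀ t y → All (λ s → length s ≡ length t ℕ.+ length y) (shufflesA t y)
shuffles-length []      y       = refl ∷ []
shuffles-length (a ∷ t) []      = cong suc (sym (NP.+-identityʳ (length t))) ∷ []
shuffles-length (a ∷ t) (b ∷ y) =
  AllP.++⁺ (AllP.map⁺ (All.map (cong suc) (shuffles-length t (b ∷ y))))
           (AllP.map⁺ (All.map (λ eq → cong suc (trans eq (sym (NP.+-suc (length t) (length y)))))
                               (shuffles-length (a ∷ t) y)))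

shuffles-1∷-⊴-0∷ : ∀ {P} t y m → length t ℕ.+ suc (length y) ≡ length m →
                   All (_⊴ l0 ∷ m ⟨≡⇒ P ⟩) (shufflesA (l1 ∷ t) (l1 ∷ y))
shuffles-1∷-⊴-0∷ t y m len =
  AllP.++⁺ (AllP.map⁺ (All.map (λ eq → 1∷-⊴-0∷ (trans eq len)) (shuffles-length t (l1 ∷ y))))
           (AllP.map⁺ (All.map (λ eq → 1∷-⊴-0∷ (trans eq (trans (sym (NP.+-suc (length t) (length y))) len)))
                               (shuffles-length (l1 ∷ t) y)))

zeros : ℕ → Tail
zeros k = replicate k l0

shuffles-zeros-⊴ : ∀ k y → All (_⊴ zeros k ++ y) (shufflesA (zeros k) y)
shuffles-zeros-⊴ zero    y       = ⊴-refl y ∷ []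
shuffles-zeros-⊴ (suc k) []      =
  subst (l0 ∷ zeros k ⊴_) (cong (l0 ∷_) (sym (LP.++-identityʳ (zeros k)))) (⊴-refl _) ∷ []
shuffles-zeros-⊴ (suc k) (b ∷ y) =
  AllP.++⁺ (AllP.map⁺ (All.map (l0 ∷_) (shuffles-zeros-⊴ k (b ∷ y))))
           (AllP.map⁺ (All.map (insert b) (shuffles-zeros-⊴ (suc k) y)))
  where
    insert : ∀ b {s} → s ⊴ l0 ∷ zeros k ++ y → b ∷ s ⊴ l0 ∷ zeros k ++ b ∷ y
    insert zero       s⊴ = l0 ∷ subst (_ ⊴_) (zeros-++-0∷ k y) s⊴
      where
        zeros-++-0∷ : ∀ k y → l0 ∷ zeros k ++ y ≡ zeros k ++ l0 ∷ y
        zeros-++-0∷ zero    y = refl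
        zeros-++-0∷ (suc k) y = cong (l0 ∷_) (zeros-++-0∷ k y)
    insert (suc zero) s⊴ = 1<0 (trans (⊴-length s⊴) (sym (LP.length-++-sucʳ (zeros k) l1 y)))

shuffles-zeros : ∀ k {y c} → y ⊴ c → All (_⊴ zeros k ++ c ⟨≡⇒ y ≡ c ⟩) (shufflesA (zeros k) y)
shuffles-zeros k {y} {c} y⊴c = All.map below (shuffles-zeros-⊴ k y)
  where
    zy⊴zc = ⊴-++ˡ (zeros k) y⊴c
    below : ∀ {s} → s ⊴ zeros k ++ y → s ⊴ zeros k ++ c ⟨≡⇒ y ≡ c ⟩
    below s⊴zy = ⊴-trans s⊴zy zy⊴zc , λ { refl → LP.++-cancelˡ (zeros k) y c (⊴-antisym zy⊴zc s⊴zy) }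

-- For u = 0 the leading words are concatenations of the blocks 10 and 110. For other
-- c, shuffles-10 fails: 0010 is a shuffle of 10 and 00 lying above 1000.
data Blocks : Tail → Set where
  []    : Blocks []
  10∷_  : ∀ {c} → Blocks c → Blocks (l1 ∷ l0 ∷ c)
  110∷_ : ∀ {c} → Blocks c → Blocks (l1 ∷ l1 ∷ l0 ∷ c)

shuffles-10 : ∀ {y c} → Blocks c → y ⊴ c →
              All (_⊴ l1 ∷ l0 ∷ c ⟨≡⇒ y ≡ c ⟩) (shufflesA (l1 ∷ l0 ∷ []) y)
shuffles-10 []     []          = (⊴-refl _ , λ _ → refl) ∷ []
shuffles-10 blocks y⊴c@(_ ∷ _) =
  AllP.++⁺ (AllP.map⁺ (All.map (∷⁺ l1) (shuffles-zeros 1 y⊴c))) (AllP.map⁺ (later blocks y⊴c))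
  where
    later : ∀ {b y c} → Blocks c → b ∷ y ⊴ c →
            All (λ s → b ∷ s ⊴ l1 ∷ l0 ∷ c ⟨≡⇒ b ∷ y ≡ c ⟩) (shufflesA (l1 ∷ l0 ∷ []) y)
    later (10∷ _) (_ ∷ 1<0 eq) =
      All.map (∷⁺ l1) (shuffles-1∷-⊴-0∷ (l0 ∷ []) _ _ (cong (2 ℕ.+_) eq))
    later (10∷ blocks) (_ ∷ (_ ∷ y⊴c)) =
      AllP.++⁺ (AllP.map⁺ (All.map (λ eq → ∷⁺ l1 (1∷-⊴-0∷ (trans eq (cong (2 ℕ.+_) (⊴-length y⊴c)))))
                                   (shuffles-length (l0 ∷ []) (l0 ∷ _))))
               (AllP.map⁺ (All.map (∷⁺ l1 ∘ ∷⁺ l0 ∘ Product.map₂ (cong (λ z → l1 ∷ l0 ∷ z) ∘_))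
                                   (shuffles-10 blocks y⊴c)))
    later (110∷ _) (_ ∷ (_ ∷ y⊴c)) =
      All.map (∷⁺ l1) (shuffles-1∷-⊴-0∷ (l0 ∷ []) _ _ (cong (2 ℕ.+_) (⊴-length y⊴c)))

-- Entries with coefficient 0 are exempt: elements are not kept reduced, and z₃ keeps
-- its entry u·100 when u = 0.
Bounded : Tail → ℚ × WordA → Set
Bounded m (c , (f , y)) = c ≡ 0ℚ ⊎ (f ≡ l1 × y ⊴ m)

record Leads (e : EltA) (m : Tail) : Set where
  field
    bounded : All (Bounded m) e
    leading : coeffA e (l1 , m) ≢ 0ℚ

coeff-bounded : ∀ {m y} e → All (Bounded m) e → coeffA e (l1 , y) ≢ 0ℚ → y ⊴ m
coeff-bounded []                   []             coeff≢0 = ⊥-elim (coeff≢0 refl)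
coeff-bounded {y = y} ((c , w) ∷ e) (bound ∷ bounds) coeff≢0 with w ≟WA (l1 , y) | bound
... | no _     | _                = coeff-bounded e bounds coeff≢0
... | yes refl | inj₂ (_ , y⊴m)   = y⊴m
... | yes refl | inj₁ refl        =
  coeff-bounded e bounds (coeff≢0 ∘ trans (QP.+-identityˡ (coeffA e (l1 , y))))

ShufflesBelow : Tail → Tail → Tail → Set
ShufflesBelow ℓ T₀ T =
  ∀ {y} → y ⊴ ℓ → All (_⊴ T₀ ++ l1 ∷ ℓ ⟨≡⇒ T ≡ T₀ × y ≡ ℓ ⟩) (shufflesA T (l1 ∷ y))

FactorBelow : Tail → Tail → ℚ × WordA → Set
FactorBelow ℓ T₀ (c , (f , T)) = c ≡ 0ℚ ⊎ (f ≡ l1 × ShufflesBelow ℓ T₀ T)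

multiplicity : Tail → Tail → ℚ
multiplicity T₀ ℓ = sumBy (ZA.δ (l1 , T₀ ++ l1 ∷ ℓ)) ((l1 , T₀) ≺WA (l1 , ℓ))

multiplicity-≢0 : ∀ T₀ ℓ → multiplicity T₀ ℓ ≢ 0ℚ
multiplicity-≢0 T₀ ℓ = ZA.sumBy-δ-∈ (∈-map⁺ (l1 ,_) (ZA.++∈shuffles T₀ (l1 ∷ ℓ)))

concatMap⁺ : ∀ {A B : Set} {P : B → Set} {f : A → List B} {xs} →
             All (λ x → All P (f x)) xs → All P (concatMap f xs)
concatMap⁺ = AllP.concat⁺ ∘ AllP.map⁺

_≟T_ : DecidableEquality Tail
_≟T_ = LP.≡-dec FinP._≟_

module _ {ℓ T₀ : Tail} where

  ≺-bounded : ∀ {g e} → All (FactorBelow ℓ T₀) g → All (Bounded ℓ) e →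
              All (Bounded (T₀ ++ l1 ∷ ℓ)) (g ≺A e)
  ≺-bounded g-below e-bounded =
    concatMap⁺ (All.map (λ { {c , (f , T)} factor →
      concatMap⁺ (All.map (λ { {d , (f′ , y)} bound → product factor bound }) e-bounded) }) g-below)
    where
      M = T₀ ++ l1 ∷ ℓ
      zero-coefficients : ∀ {k} L → k ≡ 0ℚ → All (Bounded M) (map (k ,_) L)
      zero-coefficients []      k≡0 = []
      zero-coefficients (_ ∷ L) k≡0 = inj₁ k≡0 ∷ zero-coefficients L k≡0
      product : ∀ {c f T d f′ y} → FactorBelow ℓ T₀ (c , (f , T)) → Bounded ℓ (d , (f′ , y)) →
                All (Bounded M) (map (c * d ,_) ((f , T) ≺WA (f′ , y)))
      product (inj₁ c≡0) _ = zero-coefficients _ (*-≡0 (inj₁ c≡0))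
      product {c} (inj₂ _) (inj₁ d≡0) = zero-coefficients _ (*-≡0 {c} (inj₂ d≡0))
      product (inj₂ (refl , below)) (inj₂ (refl , y⊴ℓ)) =
        AllP.map⁺ (AllP.map⁺ (All.map (λ s⊴M → inj₂ (refl , proj₁ s⊴M)) (below y⊴ℓ)))

  shuffles-miss : ∀ {T y} → ShufflesBelow ℓ T₀ T → y ⊴ ℓ → ¬ (T ≡ T₀ × y ≡ ℓ) →
    sumBy (ZA.δ (l1 , T₀ ++ l1 ∷ ℓ)) ((l1 , T) ≺WA (l1 , y)) ≡ 0ℚ
  shuffles-miss {T} {y} below y⊴ℓ miss =
    trans (sumBy-map (ZA.δ (l1 , M)) (l1 ,_) (shufflesA T (l1 ∷ y)))
          (sumBy-vanish (All.map (λ {s} s⊴M → ZA.δ-≢ {l1 , M} {l1 , s} (miss ∘ proj₂ s⊴M ∘ cong proj₂))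
                                 (below y⊴ℓ)))
    where M = T₀ ++ l1 ∷ ℓ

  shuffle-count : ∀ {T y} → ShufflesBelow ℓ T₀ T → y ⊴ ℓ →
    sumBy (ZA.δ (l1 , T₀ ++ l1 ∷ ℓ)) ((l1 , T) ≺WA (l1 , y)) ≡
    ZA.δ (l1 , T₀) (l1 , T) * (multiplicity T₀ ℓ * ZA.δ (l1 , ℓ) (l1 , y))
  shuffle-count {T} {y} below y⊴ℓ = by-cases (T ≟T T₀) (y ≟T ℓ)
    where
      μ = multiplicity T₀ ℓ
      by-cases : Dec (T ≡ T₀) → Dec (y ≡ ℓ) →
        sumBy (ZA.δ (l1 , T₀ ++ l1 ∷ ℓ)) ((l1 , T) ≺WA (l1 , y)) ≡
        ZA.δ (l1 , T₀) (l1 , T) * (μ * ZA.δ (l1 , ℓ) (l1 , y))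
      by-cases (yes refl) (yes refl) = sym (begin
        ZA.δ (l1 , T₀) (l1 , T₀) * (μ * ZA.δ (l1 , ℓ) (l1 , ℓ))
          ≡⟨ cong₂ (λ a b → a * (μ * b)) (ZA.δ-refl (l1 , T₀)) (ZA.δ-refl (l1 , ℓ)) ⟩
        1ℚ * (μ * 1ℚ)
          ≡⟨ trans (QP.*-identityˡ _) (QP.*-identityʳ μ) ⟩
        μ ∎)
        where open ≡-Reasoning
      by-cases (no T≢T₀) _ =
        trans (shuffles-miss below y⊴ℓ (T≢T₀ ∘ proj₁))
              (sym (*-≡0 {ZA.δ (l1 , T₀) (l1 , T)} (inj₁ (ZA.δ-≢ {l1 , T₀} {l1 , T} (T≢T₀ ∘ cong proj₂)))))
      by-cases (yes refl) (no y≢ℓ) =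
        trans (shuffles-miss below y⊴ℓ (y≢ℓ ∘ proj₂))
              (sym (*-≡0 {ZA.δ (l1 , T₀) (l1 , T₀)} (inj₂ (*-≡0 {μ}
                   (inj₂ (ZA.δ-≢ {l1 , ℓ} {l1 , y} (y≢ℓ ∘ cong proj₂)))))))

  coeff-≺-leading : ∀ {g e} → All (FactorBelow ℓ T₀) g → All (Bounded ℓ) e →
    coeffA (g ≺A e) (l1 , T₀ ++ l1 ∷ ℓ) ≡ coeffA g (l1 , T₀) * (multiplicity T₀ ℓ * coeffA e (l1 , ℓ))
  coeff-≺-leading {g} {e} g-below e-bounded = begin
    coeffA (g ≺A e) x
      ≡⟨ ZA.coeff-eval (g ≺A e) x ⟩
    eval (ZA.δ x) (g ≺A e)
      ≡⟨ ZA.eval-≺ (ZA.δ x) g e ⟩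
    eval (λ w → eval (λ w′ → sumBy (ZA.δ x) (w ≺WA w′)) e) g
      ≡⟨ eval-congᴬ (All.map row g-below) ⟩
    eval (λ w → ZA.δ (l1 , T₀) w * K) g
      ≡⟨ eval-*ʳ K (ZA.δ (l1 , T₀)) g ⟩
    eval (ZA.δ (l1 , T₀)) g * K
      ≡⟨ cong (_* K) (sym (ZA.coeff-eval g (l1 , T₀))) ⟩
    coeffA g (l1 , T₀) * K ∎
    where
      open ≡-Reasoning
      x = (l1 , T₀ ++ l1 ∷ ℓ)
      μ = multiplicity T₀ ℓ
      K = μ * coeffA e (l1 , ℓ)
      row : ∀ {entry} → FactorBelow ℓ T₀ entry → proj₁ entry ≡ 0ℚ ⊎
            eval (λ w′ → sumBy (ZA.δ x) (proj₂ entry ≺WA w′)) e ≡ ZA.δ (l1 , T₀) (proj₂ entry) * K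
      row (inj₁ c≡0) = inj₁ c≡0
      row {c , (_ , T)} (inj₂ (refl , below)) = inj₂ (begin
        eval (λ w′ → sumBy (ZA.δ x) ((l1 , T) ≺WA w′)) e
          ≡⟨ eval-congᴬ (All.map count e-bounded) ⟩
        eval (λ w′ → ZA.δ (l1 , T₀) (l1 , T) * (μ * ZA.δ (l1 , ℓ) w′)) e
          ≡⟨ eval-*ˡ (ZA.δ (l1 , T₀) (l1 , T)) _ e ⟩
        ZA.δ (l1 , T₀) (l1 , T) * eval (λ w′ → μ * ZA.δ (l1 , ℓ) w′) e
          ≡⟨ cong (ZA.δ (l1 , T₀) (l1 , T) *_)
                  (trans (eval-*ˡ μ _ e) (cong (μ *_) (sym (ZA.coeff-eval e (l1 , ℓ))))) ⟩
        ZA.δ (l1 , T₀) (l1 , T) * K ∎)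
        where
          count : ∀ {entry} → Bounded ℓ entry → proj₁ entry ≡ 0ℚ ⊎
            sumBy (ZA.δ x) ((l1 , T) ≺WA proj₂ entry) ≡ ZA.δ (l1 , T₀) (l1 , T) * (μ * ZA.δ (l1 , ℓ) (proj₂ entry))
          count (inj₁ d≡0)           = inj₁ d≡0
          count (inj₂ (refl , y⊴ℓ)) = inj₂ (shuffle-count below y⊴ℓ)

  leads-≺ : ∀ {g e} → All (FactorBelow ℓ T₀) g → coeffA g (l1 , T₀) ≢ 0ℚ → Leads e ℓ →
            Leads (g ≺A e) (T₀ ++ l1 ∷ ℓ)
  leads-≺ g-below g≢0 e-leads = record
    { bounded = ≺-bounded g-below (Leads.bounded e-leads)
    ; leading = λ coeff≡0 → *-≢0 g≢0 (*-≢0 (multiplicity-≢0 T₀ ℓ) (Leads.leading e-leads))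
        (trans (sym (coeff-≺-leading g-below (Leads.bounded e-leads))) coeff≡0)
    }

-- Injectivity

module Injectivity (u v : ℚ) (ℓ : WordX → Tail) (ℓ-injective : ∀ {w w′} → ℓ w ≡ ℓ w′ → w ≡ w′)
                   (leads : ∀ a t → Leads (φword′ u v a t) (ℓ (a , t))) where
  open Morphism u v
  open Extrema ⊑-totalOrder using (argmax; argmax-all; f[xs]≤f[argmax])
  open TotalOrder ⊑-totalOrder using () renaming (antisym to ⊑-antisym)
  open ZX using () renaming (_⊖_ to _⊖X_)

  leadsʷ : ∀ w → Leads (φw w) (ℓ w)
  leadsʷ (a , t) = leads a t

  coeff-φ : ∀ r x → coeffA (φ u v r) x ≡ eval (λ w → coeffA (φw w) x) r
  coeff-φ r x = trans (ZA.coeff-eval (φ u v r) x)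
    (trans (eval-φ (ZA.δ x) r) (eval-cong r (λ w → sym (ZA.coeff-eval (φw w) x))))

  φ-kernel : ∀ r → (∀ x → coeffA (φ u v r) x ≡ 0ℚ) → ∀ w → coeffX r w ≡ 0ℚ
  φ-kernel r φr≡0 w₀ with coeffX r w₀ QP.≟ 0ℚ
  ... | yes c≡0 = c≡0
  ... | no  c≢0 = ⊥-elim (*-≢0 cw≢0 (Leads.leading (leadsʷ w)) (trans (sym top) (φr≡0 (l1 , ℓ w))))
    where
      nonzero? = λ w → ¬? (coeffX r w QP.≟ 0ℚ)
      support = filter nonzero? (map proj₂ r)
      -- w has the largest leading tail in the support of r, so it is the only word of r
      -- contributing to the coefficient of its leading word in φ r.
      w = argmax ℓ w₀ support
      cw≢0 : coeffX r w ≢ 0ℚ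
      cw≢0 = argmax-all ℓ c≢0 (AllP.all-filter nonzero? (map proj₂ r))
      maximal : ∀ {w′} → coeffX r w′ ≢ 0ℚ → ℓ w′ ⊑ ℓ w
      maximal c′≢0 = All.lookup (f[xs]≤f[argmax] {f = ℓ} w₀ support)
                                (∈-filter⁺ nonzero? (ZX.coeff-≢0⇒∈ r c′≢0) c′≢0)
      others : ∀ w′ → w′ ≢ w → coeffX r w′ ≡ 0ℚ ⊎ coeffA (φw w′) (l1 , ℓ w) ≡ 0ℚ
      others w′ w′≢w with coeffX r w′ QP.≟ 0ℚ | coeffA (φw w′) (l1 , ℓ w) QP.≟ 0ℚ
      ... | yes c′≡0 | _       = inj₁ c′≡0
      ... | no  _    | yes h≡0 = inj₂ h≡0
      ... | no  c′≢0 | no  h≢0 = ⊥-elim (w′≢w (ℓ-injective (⊑-antisym (maximal c′≢0)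
                                    (inj₂ (coeff-bounded (φw w′) (Leads.bounded (leadsʷ w′)) h≢0)))))
      top : coeffA (φ u v r) (l1 , ℓ w) ≡ coeffX r w * coeffA (φw w) (l1 , ℓ w)
      top = trans (coeff-φ r _) (ZX.eval-concentrated r w others)

  φ-injective : ∀ p q → φ u v p ≈A φ u v q → p ≈X q
  φ-injective p q φp≈φq w = x∙y⁻¹≈ε⇒x≈y _ _
    (trans (sym (ZX.coeff-⊖ p q w)) (φ-kernel (p ⊖X q) difference-vanishes w))
    where
      difference-vanishes : ∀ x → coeffA (φ u v (p ⊖X q)) x ≡ 0ℚ
      difference-vanishes x = begin
        coeffA (φ u v (p ⊖X q)) x                        ≡⟨ coeff-φ (p ⊖X q) x ⟩
        eval (λ w → coeffA (φw w) x) (p ⊖X q)            ≡⟨ ZX.eval-⊖ _ p q ⟩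
        eval (λ w → coeffA (φw w) x) p - eval (λ w → coeffA (φw w) x) q
                                                         ≡⟨ sym (cong₂ _-_ (coeff-φ p x) (coeff-φ q x)) ⟩
        coeffA (φ u v p) x - coeffA (φ u v q) x          ≡⟨ cong (_- coeffA (φ u v q) x) (φp≈φq x) ⟩
        coeffA (φ u v q) x - coeffA (φ u v q) x          ≡⟨ QP.+-inverseʳ (coeffA (φ u v q) x) ⟩
        0ℚ                                               ∎
        where open ≡-Reasoning

data Boundary : Tail → Set where
  end : Boundary []
  1∷_ : ∀ r → Boundary (l1 ∷ r)

module LeadingTail (tail : Gen → Tail) where

  rest : List Gen → Tail
  rest = concatMap (λ b → l1 ∷ tail b)

  leadingTail : WordX → Tail
  leadingTail (a , t) = tail a ++ rest t

  rest-boundary : ∀ t → Boundary (rest t)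
  rest-boundary []      = end
  rest-boundary (b ∷ t) = 1∷ _

  module _ (separated : ∀ {a a′ r r′} → Boundary r → Boundary r′ → tail a ++ r ≡ tail a′ ++ r′ → a ≡ a′)
    where

    split : ∀ {a a′} t t′ → leadingTail (a , t) ≡ leadingTail (a′ , t′) → a ≡ a′ × rest t ≡ rest t′
    split {a} t t′ eq with separated (rest-boundary t) (rest-boundary t′) eq
    ... | refl = refl , LP.++-cancelˡ (tail a) (rest t) (rest t′) eq

    rest-injective : ∀ {t t′} → rest t ≡ rest t′ → t ≡ t′
    rest-injective {[]}    {[]}     _  = refl
    rest-injective {b ∷ t} {b′ ∷ t′} eq with split t t′ (LP.∷-injectiveʳ eq)
    ... | refl , eq′ = cong (b ∷_) (rest-injective eq′)

    leadingTail-injective : ∀ {w w′} → leadingTail w ≡ leadingTail w′ → w ≡ w′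
    leadingTail-injective {a , t} {a′ , t′} eq with split t t′ eq
    ... | refl , eq′ = cong (a ,_) (rest-injective eq′)

self-below : ∀ {ℓ T} →
  (∀ {y} → y ⊴ ℓ → All (_⊴ T ++ l1 ∷ ℓ ⟨≡⇒ l1 ∷ y ≡ l1 ∷ ℓ ⟩) (shufflesA T (l1 ∷ y))) →
  ShufflesBelow ℓ T T
self-below below y⊴ℓ =
  All.map (Product.map₂ (λ reach s≡M → refl , LP.∷-injectiveʳ (reach s≡M))) (below y⊴ℓ)

leads-z₂≺ : ∀ {e ℓ} → Leads e ℓ → Leads (z₂ ≺A e) (l0 ∷ l1 ∷ ℓ)
leads-z₂≺ {e} {ℓ} = leads-≺ {ℓ} {l0 ∷ []} {z₂} {e}
  (inj₂ (refl , self-below (λ y⊴ℓ → shuffles-zeros 1 (l1 ∷ y⊴ℓ))) ∷ []) (λ ())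

module NonzeroU (u v : ℚ) (u≢0 : u ≢ 0ℚ) where

  tail : Gen → Tail
  tail x₂ = l0 ∷ []
  tail x₃ = l0 ∷ l0 ∷ []

  open LeadingTail tail

  separated : ∀ {a a′ r r′} → Boundary r → Boundary r′ → tail a ++ r ≡ tail a′ ++ r′ → a ≡ a′
  separated {x₂} {x₂} _      _      _  = refl
  separated {x₃} {x₃} _      _      _  = refl
  separated {x₂} {x₃} end    _      ()
  separated {x₂} {x₃} (1∷ _) _      ()
  separated {x₃} {x₂} _      end    ()
  separated {x₃} {x₂} _      (1∷ _) ()

  leads-z₃≺ : ∀ {e ℓ} → Leads e ℓ → Leads (z₃ u v ≺A e) (l0 ∷ l0 ∷ l1 ∷ ℓ)
  leads-z₃≺ {e} {ℓ} = leads-≺ {ℓ} {l0 ∷ l0 ∷ []} {z₃ u v} {e}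
    (inj₂ (refl , self-below (λ y⊴ℓ → shuffles-zeros 2 (l1 ∷ y⊴ℓ))) ∷
     inj₂ (refl , λ y⊴ℓ → shuffles-1∷-⊴-0∷ (l0 ∷ []) _ _ (cong (2 ℕ.+_) (⊴-length y⊴ℓ))) ∷ [])
    (u≢0 ∘ trans (sym (QP.+-identityʳ u)))

  leads : ∀ a t → Leads (φword′ u v a t) (leadingTail (a , t))
  leads x₂ []      = record { bounded = inj₂ (refl , ⊴-refl _) ∷ [] ; leading = λ () }
  leads x₃ []      = record
    { bounded = inj₂ (refl , ⊴-refl _) ∷ inj₂ (refl , 1<0 refl) ∷ []
    ; leading = u≢0 ∘ trans (sym (QP.+-identityʳ u))
    }
  leads x₂ (b ∷ t) = leads-z₂≺ (leads b t)
  leads x₃ (b ∷ t) = leads-z₃≺ (leads b t)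

  open Injectivity u v leadingTail (leadingTail-injective separated) leads public

module ZeroU (u v : ℚ) (u≡0 : u ≡ 0ℚ) (v≢0 : v ≢ 0ℚ) where

  tail : Gen → Tail
  tail x₂ = l0 ∷ []
  tail x₃ = l1 ∷ l0 ∷ []

  open LeadingTail tail

  separated : ∀ {a a′ r r′} → Boundary r → Boundary r′ → tail a ++ r ≡ tail a′ ++ r′ → a ≡ a′
  separated {x₂} {x₂} _ _ _  = refl
  separated {x₃} {x₃} _ _ _  = refl
  separated {x₂} {x₃} _ _ ()
  separated {x₃} {x₂} _ _ ()

  blocks : ∀ a t → Blocks (l1 ∷ leadingTail (a , t))
  blocks x₂ []      = 10∷ []
  blocks x₃ []      = 110∷ []
  blocks x₂ (b ∷ t) = 10∷ blocks b t
  blocks x₃ (b ∷ t) = 110∷ blocks b t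

  leads-z₃≺ : ∀ {e ℓ} → Blocks (l1 ∷ ℓ) → Leads e ℓ → Leads (z₃ u v ≺A e) (l1 ∷ l0 ∷ l1 ∷ ℓ)
  leads-z₃≺ {e} {ℓ} ℓ-blocks = leads-≺ {ℓ} {l1 ∷ l0 ∷ []} {z₃ u v} {e}
    (inj₁ u≡0 ∷ inj₂ (refl , self-below (λ y⊴ℓ → shuffles-10 ℓ-blocks (l1 ∷ y⊴ℓ))) ∷ [])
    (v≢0 ∘ trans (sym (QP.+-identityʳ v)))

  leads : ∀ a t → Leads (φword′ u v a t) (leadingTail (a , t))
  leads x₂ []      = record { bounded = inj₂ (refl , ⊴-refl _) ∷ [] ; leading = λ () }
  leads x₃ []      = record
    { bounded = inj₁ u≡0 ∷ inj₂ (refl , ⊴-refl _) ∷ []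
    ; leading = v≢0 ∘ trans (sym (QP.+-identityʳ v))
    }
  leads x₂ (b ∷ t) = leads-z₂≺ (leads b t)
  leads x₃ (b ∷ t) = leads-z₃≺ (blocks b t) (leads b t)

  open Injectivity u v leadingTail (leadingTail-injective separated) leads public

mainTheorem1 : (u v : ℚ) → ¬ (u ≡ 0ℚ × v ≡ 0ℚ) →
    ((∀ p q → p ≈X q → φ u v p ≈A φ u v q)
     × (∀ p q → φ u v (p ≺X q) ≈A (φ u v p ≺A φ u v q))
     × (∀ p → InC u v (φ u v p))
     × (∀ a → InC u v a → ∃ λ p → φ u v p ≈A a)
     × (∀ p q → φ u v p ≈A φ u v q → p ≈X q))
mainTheorem1 u v not-both-zero =
    φ-cong
  , (λ p q → ZA.≐⇒≈ {φ u v (p ≺X q)} {φ u v p ≺A φ u v q} (φ-≺ p q))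
  , φ-InC
  , (λ a a∈C → let p , φp≐a = InC⇒image a∈C in p , ZA.≐⇒≈ {φ u v p} {a} φp≐a)
  , injective
  where
    open Morphism u v
    injective : ∀ p q → φ u v p ≈A φ u v q → p ≈X q
    injective with u QP.≟ 0ℚ
    ... | yes u≡0 = ZeroU.φ-injective u v u≡0 (λ v≡0 → not-both-zero (u≡0 , v≡0))
    ... | no  u≢0 = NonzeroU.φ-injective u v u≢0
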